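{- Let $G=(V,E)$ be a finite bipartite graph and let $\{T_v : v\in V\}$ be a bipartite triangle containment representation of $G$ in which the barycenters of the triangles $T_v$ are pairwise distinct. Let $\beta(G)$ be the straight-line drawing of $G$ in which each vertex $v$ is placed at the barycenter of $T_v$ and each edge is drawn as the segment between its endpoints. If $e=uv$ and $f=xy$ are two strongly independent edges of $G$, then the segments representing $e$ and $f$ in $\beta(G)$ do not cross (they have no common point).
   Context: A bipartite triangle containment representation of a bipartite graph $G=(V,E)$ is an assignment of a triangle $T_v$ in the plane to each vertex $v$, all triangles being pairwise homothetic (obtained from one another by positive scaling and translation), such that for distinct $u,v\in V$: $uv\in E$ if and only if $T_u\subseteq T_v$ or $T_v\subseteq T_u$. Two edges $e,f$ of $G$ are strongly independent if they share no vertex and they are the only edges of $G$ induced on their four endpoints. -}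

module Defs where

open import Level using (Level; _⊔_) renaming (suc to lsuc)
open import Data.Bool using (Bool; true; false)
open import Data.Nat using (ℕ)
open import Data.Fin using (Fin)
open import Data.Product using (Σ; _×_; _,_; ∃; ∃-syntax)
open import Data.Sum using (_⊎_)
open import Relation.Binary.PropositionalEquality using (_≡_; _≢_)
open import Relation.Binary.Structures using (IsStrictTotalOrder)
open import Algebra.Structures using (IsCommutativeRing)
open import Function.Bundles using (_⇔_)
open import Relation.Nullary using (¬_)

record OrderedField (c ℓ : Level) : Set (lsuc (c ⊔ ℓ)) where
  infixl 6 _+_
  infixl 7 _*_
  infix 4 _<_ _≤_
  field
    Carrier : Set c
    _+_ _*_ : Carrier → Carrier → Carrier
    -_ : Carrier → Carrier
    0# 1# : Carrier
    _<_ : Carrier → Carrier → Set ℓ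
    isCommutativeRing : IsCommutativeRing _≡_ _+_ _*_ -_ 0# 1#
    isStrictTotalOrder : IsStrictTotalOrder _≡_ _<_
    0≢1 : 0# ≢ 1#
    inverse : ∀ a → a ≢ 0# → ∃[ b ] (a * b ≡ 1#)
    +-mono-< : ∀ a b c → a < b → a + c < b + c
    *-pos : ∀ a b → 0# < a → 0# < b → 0# < a * b

  _≤_ : Carrier → Carrier → Set (c ⊔ ℓ)
  a ≤ b = (a < b) ⊎ (a ≡ b)

  _-_ : Carrier → Carrier → Carrier
  a - b = a + (- b)

module Geometry {c ℓ : Level} (F : OrderedField c ℓ) where
  open OrderedField F

  Point : Set c
  Point = Carrier × Carrier

  _⊕_ : Point → Point → Point
  (a , b) ⊕ (a' , b') = (a + a' , b + b')

  _·_ : Carrier → Point → Point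
  s · (a , b) = (s * a , s * b)

  record Triangle : Set c where
    constructor tri
    field
      A B C : Point

  NonDegenerate : Triangle → Set c
  NonDegenerate (tri (a₁ , a₂) (b₁ , b₂) (c₁ , c₂)) =
    ((b₁ - a₁) * (c₂ - a₂)) - ((b₂ - a₂) * (c₁ - a₁)) ≢ 0#

  _∈T_ : Point → Triangle → Set (c ⊔ ℓ)
  p ∈T tri A B C = ∃[ α ] ∃[ β ] ∃[ γ ]
    (0# ≤ α × 0# ≤ β × 0# ≤ γ × α + β + γ ≡ 1# ×
     p ≡ (α · A) ⊕ ((β · B) ⊕ (γ · C)))

  _⊆T_ : Triangle → Triangle → Set (c ⊔ ℓ)
  S ⊆T T = ∀ p → p ∈T S → p ∈T T

  homothet : Triangle → Carrier → Point → Triangle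
  homothet (tri A B C) λ' t = tri ((λ' · A) ⊕ t) ((λ' · B) ⊕ t) ((λ' · C) ⊕ t)

  IsBarycenter : Point → Triangle → Set c
  IsBarycenter g (tri A B C) = g ⊕ (g ⊕ g) ≡ A ⊕ (B ⊕ C)

  OnSegment : Point → Point → Point → Set (c ⊔ ℓ)
  OnSegment p P Q = ∃[ s ] (0# ≤ s × s ≤ 1# × p ≡ ((1# - s) · P) ⊕ (s · Q))

  SegmentsMeet : Point → Point → Point → Point → Set (c ⊔ ℓ)
  SegmentsMeet P Q R S = ∃[ p ] (OnSegment p P Q × OnSegment p R S)

record Graph (n : ℕ) : Set where
  field
    adj : Fin n → Fin n → Bool
    adj-sym : ∀ u v → adj u v ≡ adj v u
    adj-irrefl : ∀ v → adj v v ≡ false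

module _ {n : ℕ} (G : Graph n) where
  open Graph G

  Edge : Fin n → Fin n → Set
  Edge u v = adj u v ≡ true

  IsBipartite : Set
  IsBipartite = Σ (Fin n → Bool) λ col → ∀ u v → Edge u v → col u ≢ col v

  StronglyIndependent : Fin n → Fin n → Fin n → Fin n → Set
  StronglyIndependent u v x y =
    Edge u v × Edge x y ×
    u ≢ x × u ≢ y × v ≢ x × v ≢ y ×
    adj u x ≡ false × adj u y ≡ false × adj v x ≡ false × adj v y ≡ false

module Representation {c ℓ : Level} (F : OrderedField c ℓ) where
  open OrderedField F
  open Geometry F

  -- All triangles are positive homothets  T v = λ v · T₀ + t v  of one
  -- nondegenerate reference triangle T₀ (equivalently: pairwise homothetic).
  record BTCRep {n : ℕ} (G : Graph n) : Set (lsuc (c ⊔ ℓ)) where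
    field
      T₀ : Triangle
      T₀-nondeg : NonDegenerate T₀
      scale : Fin n → Carrier
      scale-pos : ∀ v → 0# < scale v
      shift : Fin n → Point

    T : Fin n → Triangle
    T v = homothet T₀ (scale v) (shift v)

    field
      represents : ∀ u v → u ≢ v →
        (Edge G u v ⇔ ((T u ⊆T T v) ⊎ (T v ⊆T T u)))

module Submission where

open import Defs
open import Level using (Level; _⊔_)
open import Algebra.Bundles using (CommutativeRing; RawRing)
open import Algebra.Solver.Ring.AlmostCommutativeRing using (fromCommutativeRing; _-Raw-AlmostCommutative⟶_)
import Algebra.Solver.Ring as HornerSolver
open import Data.Bool using (false)
open import Data.Fin using (Fin)
open import Data.Integer as ℤ using (ℤ; +_; -[1+_]; _⊖_; sign; ∣_∣; _◃_)
import Data.Integer.Properties as ℤ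
open import Data.Maybe using (Maybe; just; nothing)
open import Data.Nat as ℕ using (ℕ; zero; suc)
import Data.Nat.Properties as ℕ
open import Data.Product using (Σ; _×_; _,_; proj₁; proj₂; ∃-syntax)
open import Data.Sign as Sign using (Sign)
open import Data.Empty using (⊥-elim)
open import Data.Sum using (_⊎_; inj₁; inj₂)
open import Function.Bundles using (module Equivalence)
import Relation.Binary.Construct.StrictToNonStrict as StrictToNonStrict
open import Relation.Binary.Definitions using (tri<; tri≈; tri>)
import Relation.Binary.PropositionalEquality as ≡
open import Relation.Binary.Structures using (IsStrictTotalOrder; IsTotalOrder)
open import Relation.Nullary using (¬_; yes; no)

-- Write T v = s_v·T₀ + t_v.  Each side i of T₀ has a linear height functional,
-- constant (= level i v) along side i of every T v and growing towards the
-- opposite vertex.  (1) T v is cut out by the three half-planes level i v ≤ height i,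
-- so T a ⊆ T b iff every level of b is at most that of a: edges of G are exactly
-- the comparable pairs.  (2) 3·height i (g v) = 3·level i v + s_v·w_i with w_i > 0.
-- If the drawn edges uv, xy met at p = (1-s)g_u + s g_v = (1-r)g_x + r g_y, linearity
-- gives 3·M_uv i + σ w_i = 3·M_xy i + τ w_i for the mixed levels M and scales σ, τ.
-- Say σ ≤ τ; then M_xy ≤ M_uv on every side, and as both edges are comparable
-- pairs an endpoint of uv and an endpoint of xy are comparable, i.e. adjacent.

-- The library's solvers over the ring's own carrier only decide identities whose
-- coefficient arithmetic computes; for an abstract ring we instead interpret ℤ via
-- the canonical homomorphism, so that normal forms are compared in ℤ.
module IntegerCoefficientSolver {c ℓ} (R : CommutativeRing c ℓ) where

  open CommutativeRing R
  open import Algebra.Properties.Ring ring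
  open import Algebra.Properties.Monoid.Mult.TCOptimised +-monoid using (1+×; ×-homo-+) renaming (_×_ to _×ᴺ_)
  open import Algebra.Properties.Semiring.Mult.TCOptimised semiring using (×1-homo-*)
  open import Relation.Binary.Reasoning.Setoid setoid

  ι : ℕ → Carrier
  ι n = n ×ᴺ 1#

  ⟦_⟧ : ℤ → Carrier
  ⟦ + n ⟧      = ι n
  ⟦ -[1+ n ] ⟧ = - ι (suc n)

  signed : Sign → Carrier → Carrier
  signed Sign.+ x = x
  signed Sign.- x = - x

  ⟦◃⟧ : ∀ s n → ⟦ s ◃ n ⟧ ≈ signed s (ι n)
  ⟦◃⟧ Sign.+ zero    = refl
  ⟦◃⟧ Sign.- zero    = sym -0#≈0#
  ⟦◃⟧ Sign.+ (suc n) = refl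
  ⟦◃⟧ Sign.- (suc n) = refl

  ⟦⟧-sign-abs : ∀ i → ⟦ i ⟧ ≈ signed (sign i) (ι ∣ i ∣)
  ⟦⟧-sign-abs (+ n)    = refl
  ⟦⟧-sign-abs -[1+ n ] = refl

  signed-* : ∀ s t x y → signed (s Sign.* t) (x * y) ≈ signed s x * signed t y
  signed-* Sign.+ Sign.+ x y = refl
  signed-* Sign.+ Sign.- x y = -‿distribʳ-* x y
  signed-* Sign.- Sign.+ x y = -‿distribˡ-* x y
  signed-* Sign.- Sign.- x y = begin
    x * y         ≈⟨ -‿involutive (x * y) ⟨
    - - (x * y)   ≈⟨ -‿cong (-‿distribˡ-* x y) ⟩
    - (- x * y)   ≈⟨ -‿distribʳ-* (- x) y ⟩
    - x * - y     ∎

  *-homo : ∀ i j → ⟦ i ℤ.* j ⟧ ≈ ⟦ i ⟧ * ⟦ j ⟧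
  *-homo i j = begin
    ⟦ (sign i Sign.* sign j) ◃ (∣ i ∣ ℕ.* ∣ j ∣) ⟧         ≈⟨ ⟦◃⟧ (sign i Sign.* sign j) (∣ i ∣ ℕ.* ∣ j ∣) ⟩
    signed (sign i Sign.* sign j) (ι (∣ i ∣ ℕ.* ∣ j ∣))   ≈⟨ signed-cong (sign i Sign.* sign j) (×1-homo-* ∣ i ∣ ∣ j ∣) ⟩
    signed (sign i Sign.* sign j) (ι ∣ i ∣ * ι ∣ j ∣)     ≈⟨ signed-* (sign i) (sign j) _ _ ⟩
    signed (sign i) (ι ∣ i ∣) * signed (sign j) (ι ∣ j ∣) ≈⟨ *-cong (⟦⟧-sign-abs i) (⟦⟧-sign-abs j) ⟨
    ⟦ i ⟧ * ⟦ j ⟧                                         ∎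
    where
    signed-cong : ∀ s {x y} → x ≈ y → signed s x ≈ signed s y
    signed-cong Sign.+ x≈y = x≈y
    signed-cong Sign.- x≈y = -‿cong x≈y

  -‿homo : ∀ i → ⟦ ℤ.- i ⟧ ≈ - ⟦ i ⟧
  -‿homo (+ zero)  = sym -0#≈0#
  -‿homo (+ suc n) = refl
  -‿homo -[1+ n ]  = sym (-‿involutive _)

  -‿cancel-+ˡ : ∀ x a b → (x + a) - (x + b) ≈ a - b
  -‿cancel-+ˡ x a b = begin
    (x + a) + - (x + b)     ≈⟨ +-congˡ (-‿+-comm x b) ⟨
    (x + a) + (- x + - b)   ≈⟨ +-congʳ (+-comm x a) ⟩
    (a + x) + (- x + - b)   ≈⟨ +-assoc a x _ ⟩
    a + (x + (- x + - b))   ≈⟨ +-congˡ (+-assoc x (- x) (- b)) ⟨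
    a + ((x + - x) + - b)   ≈⟨ +-congˡ (+-congʳ (-‿inverseʳ x)) ⟩
    a + (0# + - b)          ≈⟨ +-congˡ (+-identityˡ (- b)) ⟩
    a + - b                 ∎

  ⊖-homo : ∀ m n → ⟦ m ⊖ n ⟧ ≈ ι m - ι n
  ⊖-homo zero    zero    = sym (-‿inverseʳ 0#)
  ⊖-homo zero    (suc n) = sym (+-identityˡ _)
  ⊖-homo (suc m) zero    = begin
    ι (suc m)            ≈⟨ +-identityʳ _ ⟨
    ι (suc m) + 0#       ≈⟨ +-congˡ -0#≈0# ⟨
    ι (suc m) + - 0#     ∎
  ⊖-homo (suc m) (suc n) = begin
    ⟦ suc m ⊖ suc n ⟧             ≡⟨ ≡.cong ⟦_⟧ (ℤ.[1+m]⊖[1+n]≡m⊖n m n) ⟩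
    ⟦ m ⊖ n ⟧                     ≈⟨ ⊖-homo m n ⟩
    ι m - ι n                     ≈⟨ -‿cancel-+ˡ 1# (ι m) (ι n) ⟨
    (1# + ι m) - (1# + ι n)       ≈⟨ +-cong (1+× m 1#) (-‿cong (1+× n 1#)) ⟨
    ι (suc m) - ι (suc n)         ∎

  +-homo : ∀ i j → ⟦ i ℤ.+ j ⟧ ≈ ⟦ i ⟧ + ⟦ j ⟧
  +-homo (+ m)    (+ n)    = ×-homo-+ 1# m n
  +-homo (+ m)    -[1+ n ] = ⊖-homo m (suc n)
  +-homo -[1+ m ] (+ n)    = trans (⊖-homo n (suc m)) (+-comm _ _)
  +-homo -[1+ m ] -[1+ n ] = begin
    - ι (suc (suc (m ℕ.+ n)))        ≡⟨ ≡.cong (λ k → - ι (suc k)) (ℕ.+-suc m n) ⟨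
    - ι (suc m ℕ.+ suc n)            ≈⟨ -‿cong (×-homo-+ 1# (suc m) (suc n)) ⟩
    - (ι (suc m) + ι (suc n))        ≈⟨ -‿+-comm _ _ ⟨
    - ι (suc m) + - ι (suc n)        ∎

  homomorphism : ℤ.+-*-rawRing -Raw-AlmostCommutative⟶ fromCommutativeRing R
  homomorphism = record
    { ⟦_⟧ = ⟦_⟧ ; +-homo = +-homo ; *-homo = *-homo ; -‿homo = -‿homo
    ; 0-homo = refl ; 1-homo = refl }

  -- integer equality is decidable, so the solver recognises vanishing coefficients
  _≟ᶻ_ : ∀ i j → Maybe (⟦ i ⟧ ≈ ⟦ j ⟧)
  i ≟ᶻ j with i ℤ.≟ j
  ... | yes ≡.refl = just refl
  ... | no _       = nothing

  open HornerSolver ℤ.+-*-rawRing (fromCommutativeRing R) homomorphism _≟ᶻ_ public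
    using (Polynomial; solve; _:=_; _:+_; _:-_; _:*_; :-_; con)

  :0 :1 : ∀ {n} → Polynomial n
  :0 = con (+ 0)
  :1 = con (+ 1)

  polynomials : ℕ → RawRing _ _
  polynomials n = record
    { Carrier = Polynomial n ; _≈_ = ≡._≡_ ; _+_ = _:+_ ; _*_ = _:*_ ; -_ = :-_ ; 0# = :0 ; 1# = :1 }

-- They are instantiated both with
-- the ordered field (where they agree definitionally with the geometry of Defs)
-- and with solver polynomials, so each identity below is stated only once.
module Coordinates {a ℓ} (R : RawRing a ℓ) where
  open RawRing R

  _-_ : Carrier → Carrier → Carrier
  x - y = x + - y

  mix : Carrier → Carrier → Carrier → Carrier
  mix s x y = (1# - s) * x + s * y

  -- the scalar counterpart of g ⊕ (g ⊕ g) in the definition of a barycenter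
  triple : Carrier → Carrier
  triple x = x + (x + x)

  Pt : Set a
  Pt = Carrier × Carrier

  _+ᵥ_ : Pt → Pt → Pt
  (x₁ , x₂) +ᵥ (y₁ , y₂) = (x₁ + y₁ , x₂ + y₂)

  _·ᵥ_ : Carrier → Pt → Pt
  k ·ᵥ (x₁ , x₂) = (k * x₁ , k * x₂)

  _─_ : Pt → Pt → Pt
  (x₁ , x₂) ─ (y₁ , y₂) = (x₁ - y₁ , x₂ - y₂)

  cross : Pt → Pt → Carrier
  cross (x₁ , x₂) (y₁ , y₂) = (x₁ * y₂) - (x₂ * y₁)

  area : Pt → Pt → Pt → Carrier
  area X Y Z = cross (Y ─ X) (Z ─ X)

  -- a linear functional constant on lines parallel to YZ, increasing towards X;
  -- the factor area X Y Z makes X lie area² above Y and Z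
  height : Pt → Pt → Pt → Pt → Carrier
  height X Y Z p = area X Y Z * cross p (Y ─ Z)

  hom : Carrier → Pt → Pt → Pt
  hom s t X = (s ·ᵥ X) +ᵥ t

  comb : Pt → Pt → Pt → Carrier → Carrier → Carrier → Pt
  comb X Y Z α β γ = (α ·ᵥ X) +ᵥ ((β ·ᵥ Y) +ᵥ (γ ·ᵥ Z))

  level : Pt → Pt → Pt → Carrier → Pt → Carrier
  level X Y Z s t = height X Y Z (hom s t Y)

  gap : Pt → Pt → Pt → Carrier → Pt → Pt → Carrier
  gap X Y Z s t p = height X Y Z p - level X Y Z s t

open import Relation.Binary.PropositionalEquality

module OrderedFieldFacts {c ℓ} (F : OrderedField c ℓ) where
  open OrderedField F
  open IsStrictTotalOrder isStrictTotalOrder using (compare; <-respˡ-≈)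
    renaming (trans to <-trans; irrefl to <-irrefl′)

  commutativeRing : CommutativeRing c c
  commutativeRing = record { isCommutativeRing = isCommutativeRing }

  open CommutativeRing commutativeRing
    using (+-identityˡ; +-comm; -‿inverseʳ; zeroˡ; zeroʳ; *-identityˡ)
  open IntegerCoefficientSolver commutativeRing using (solve; _:=_; _:+_; _:-_; _:*_; :-_; :1; polynomials)
  private module Plane = Coordinates (CommutativeRing.rawRing commutativeRing)

  mix : Carrier → Carrier → Carrier → Carrier
  mix = Plane.mix

  triple : Carrier → Carrier
  triple = Plane.triple

  ≤-isTotalOrder : IsTotalOrder _≡_ _≤_
  ≤-isTotalOrder = StrictToNonStrict.isTotalOrder _≡_ _<_ isStrictTotalOrder

  open IsTotalOrder ≤-isTotalOrder public using () renaming (trans to ≤-trans; total to ≤-total)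

  ≤-<-trans : ∀ {x y z} → x ≤ y → y < z → x < z
  ≤-<-trans = StrictToNonStrict.≤-<-trans _≡_ _<_ sym <-trans <-respˡ-≈

  <-irrefl : ∀ {x} → ¬ (x < x)
  <-irrefl = <-irrefl′ refl

  +-monoˡ-≤ : ∀ {x y} z → x ≤ y → x + z ≤ y + z
  +-monoˡ-≤ z (inj₁ x<y) = inj₁ (+-mono-< _ _ z x<y)
  +-monoˡ-≤ z (inj₂ refl) = inj₂ refl

  ≤-by-gap : ∀ {x y} d → 0# ≤ d → x + d ≡ y → x ≤ y
  ≤-by-gap {x} d 0≤d refl = subst₂ _≤_ (+-identityˡ x) (+-comm d x) (+-monoˡ-≤ x 0≤d)

  <-by-gap : ∀ {x y} d → 0# < d → x + d ≡ y → x < y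
  <-by-gap {x} d 0<d refl = subst₂ _<_ (+-identityˡ x) (+-comm d x) (+-mono-< _ _ x 0<d)

  gap-nonneg : ∀ {x y} → x ≤ y → 0# ≤ y - x
  gap-nonneg {x} x≤y = subst (_≤ _) (-‿inverseʳ x) (+-monoˡ-≤ (- x) x≤y)

  gap-pos : ∀ {x y} → x < y → 0# < y - x
  gap-pos {x} x<y = subst (_< _) (-‿inverseʳ x) (+-mono-< _ _ (- x) x<y)

  neg-pos : ∀ {x} → x < 0# → 0# < - x
  neg-pos {x} x<0 = subst (0# <_) (+-identityˡ (- x)) (gap-pos x<0)

  pos-+ : ∀ {x y} → 0# < x → 0# < y → 0# < x + y
  pos-+ 0<x 0<y = <-trans 0<x (<-by-gap _ 0<y refl)

  nonneg-* : ∀ {x y} → 0# ≤ x → 0# ≤ y → 0# ≤ x * y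
  nonneg-* (inj₁ 0<x) (inj₁ 0<y) = inj₁ (*-pos _ _ 0<x 0<y)
  nonneg-* {y = y} (inj₂ refl) _ = inj₂ (sym (zeroˡ y))
  nonneg-* {x = x} (inj₁ _) (inj₂ refl) = inj₂ (sym (zeroʳ x))

  square-pos : ∀ {x} → x ≢ 0# → 0# < x * x
  square-pos {x} x≢0 with compare x 0#
  ... | tri< x<0 _ _ = subst (0# <_) (solve 1 (λ x → :- x :* :- x := x :* x) refl x) (*-pos _ _ (neg-pos x<0) (neg-pos x<0))
  ... | tri≈ _ x≡0 _ = ⊥-elim (x≢0 x≡0)
  ... | tri> _ _ 0<x = *-pos _ _ 0<x 0<x

  square-nonneg : ∀ x → 0# ≤ x * x
  square-nonneg x with compare x 0#
  ... | tri≈ _ refl _ = inj₂ (sym (zeroˡ 0#))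
  ... | tri< _ x≢0 _ = inj₁ (square-pos x≢0)
  ... | tri> _ x≢0 _ = inj₁ (square-pos x≢0)

  0<1 : 0# < 1#
  0<1 = subst (0# <_) (*-identityˡ 1#) (square-pos (λ 1≡0 → 0≢1 (sym 1≡0)))

  inverse-pos : ∀ {x w} → 0# < x → x * w ≡ 1# → 0# < w
  inverse-pos {x} {w} 0<x xw≡1 with compare w 0#
  ... | tri> _ _ 0<w = 0<w
  ... | tri≈ _ refl _ = ⊥-elim (0≢1 (trans (sym (zeroʳ x)) xw≡1))
  ... | tri< w<0 _ _ = ⊥-elim (<-irrefl (<-trans 0<1 (<-by-gap (x * - w) (*-pos _ _ 0<x (neg-pos w<0)) 1+x*-w≡0)))
    where
    -- x·(-w) = -1, so 1 would lie below 0
    1+x*-w≡0 : 1# + x * - w ≡ 0#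
    1+x*-w≡0 = begin
      1# + x * - w   ≡⟨ solve 2 (λ x w → :1 :+ x :* :- w := :1 :- x :* w) refl x w ⟩
      1# - (x * w)   ≡⟨ cong (λ z → 1# - z) xw≡1 ⟩
      1# - 1#        ≡⟨ -‿inverseʳ 1# ⟩
      0#             ∎
      where open ≡-Reasoning

  triple-reflects-≤ : ∀ {x y} → triple x ≤ triple y → x ≤ y
  triple-reflects-≤ {x} {y} 3x≤3y with compare x y
  ... | tri< x<y _ _ = inj₁ x<y
  ... | tri≈ _ x≡y _ = inj₂ x≡y
  ... | tri> _ _ y<x = ⊥-elim (<-irrefl (≤-<-trans 3x≤3y (<-by-gap (triple (x - y)) 0<3d 3y+3d≡3x)))
    where
    0<3d : 0# < triple (x - y)
    0<3d = let 0<d = gap-pos y<x in pos-+ 0<d (pos-+ 0<d 0<d)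
    3y+3d≡3x : triple y + triple (x - y) ≡ triple x
    3y+3d≡3x = solve 2 (λ x y → let module P = Coordinates (polynomials 2) in
      P.triple y :+ P.triple (x :- y) := P.triple x) refl x y

  ≤-cancel-weighted : ∀ {x y σ τ e} → x + σ * e ≡ y + τ * e → σ ≤ τ → 0# ≤ e → y ≤ x
  ≤-cancel-weighted {x} {y} {σ} {τ} {e} eq σ≤τ 0≤e =
    ≤-by-gap ((τ - σ) * e) (nonneg-* (gap-nonneg σ≤τ) 0≤e) (begin
      y + (τ - σ) * e         ≡⟨ solve 4 (λ y σ τ e → y :+ (τ :- σ) :* e := (y :+ τ :* e) :- σ :* e) refl y σ τ e ⟩
      (y + τ * e) - (σ * e)   ≡⟨ cong (λ z → z - (σ * e)) (sym eq) ⟩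
      (x + σ * e) - (σ * e)   ≡⟨ solve 3 (λ x σ e → (x :+ σ :* e) :- σ :* e := x) refl x σ e ⟩
      x                       ∎)
    where open ≡-Reasoning

  mix-between : ∀ {s x y} → 0# ≤ s → s ≤ 1# → x ≤ y → x ≤ mix s x y × mix s x y ≤ y
  mix-between {s} {x} {y} 0≤s s≤1 x≤y =
    ≤-by-gap (s * (y - x)) (nonneg-* 0≤s (gap-nonneg x≤y))
      (solve 3 (λ s x y → let module P = Coordinates (polynomials 3) in
        x :+ s :* (y :- x) := P.mix s x y) refl s x y) ,
    ≤-by-gap ((1# - s) * (y - x)) (nonneg-* (gap-nonneg s≤1) (gap-nonneg x≤y))
      (solve 3 (λ s x y → let module P = Coordinates (polynomials 3) in
        P.mix s x y :+ (:1 :- s) :* (y :- x) := y) refl s x y)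

  mix-between′ : ∀ {s x y} → 0# ≤ s → s ≤ 1# → y ≤ x → y ≤ mix s x y × mix s x y ≤ x
  mix-between′ {s} {x} {y} 0≤s s≤1 y≤x =
    ≤-by-gap ((1# - s) * (x - y)) (nonneg-* (gap-nonneg s≤1) (gap-nonneg y≤x))
      (solve 3 (λ s x y → let module P = Coordinates (polynomials 3) in
        y :+ (:1 :- s) :* (x :- y) := P.mix s x y) refl s x y) ,
    ≤-by-gap (s * (x - y)) (nonneg-* 0≤s (gap-nonneg y≤x))
      (solve 3 (λ s x y → let module P = Coordinates (polynomials 3) in
        P.mix s x y :+ s :* (x :- y) := x) refl s x y)

  triple-mix : ∀ s {x y lx ly a b} W → triple x ≡ triple lx + a * W → triple y ≡ triple ly + b * W →
    triple (mix s x y) ≡ triple (mix s lx ly) + mix s a b * W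
  triple-mix s {x} {y} {lx} {ly} {a} {b} W 3x≡ 3y≡ = begin
    triple (mix s x y)                                ≡⟨ solve 3 (λ s x y → let module P = Coordinates (polynomials 3) in
                                                           P.triple (P.mix s x y) := P.mix s (P.triple x) (P.triple y)) refl s x y ⟩
    mix s (triple x) (triple y)                       ≡⟨ cong₂ (mix s) 3x≡ 3y≡ ⟩
    mix s (triple lx + a * W) (triple ly + b * W)     ≡⟨ solve 6 (λ s lx ly a b W → let module P = Coordinates (polynomials 6) in
                                                           P.mix s (P.triple lx :+ a :* W) (P.triple ly :+ b :* W)
                                                             := P.triple (P.mix s lx ly) :+ P.mix s a b :* W) refl s lx ly a b W ⟩
    triple (mix s lx ly) + mix s a b * W              ∎
    where open ≡-Reasoning

-- For the side BC, heightOf T is a linear functional constant along BC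
-- with A lying areaOf T ² above it; the other sides are handled by relabelling
-- the vertices cyclically (orient).
module TriangleHeights {c ℓ} (F : OrderedField c ℓ) where
  open OrderedField F
  open Geometry F
  open OrderedFieldFacts F
  open CommutativeRing commutativeRing using (+-identityˡ; +-identityʳ; *-identityˡ; *-comm)
  open IntegerCoefficientSolver commutativeRing
    using (solve; _:=_; _:+_; _:-_; _:*_; :0; :1; polynomials)
  private module Plane = Coordinates (CommutativeRing.rawRing commutativeRing)

  areaOf : Triangle → Carrier
  areaOf (tri A B C) = Plane.area A B C

  heightOf : Triangle → Point → Carrier
  heightOf (tri A B C) = Plane.height A B C

  levelOf : Triangle → Carrier → Point → Carrier
  levelOf (tri A B C) = Plane.level A B C

  gapOf : Triangle → Carrier → Point → Point → Carrier
  gapOf (tri A B C) = Plane.gap A B C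

  combination : Triangle → Carrier → Carrier → Carrier → Point
  combination (tri A B C) α β γ = (α · A) ⊕ ((β · B) ⊕ (γ · C))

  rotate : Triangle → Triangle
  rotate (tri A B C) = tri B C A

  area-rotate : ∀ T → areaOf (rotate T) ≡ areaOf T
  area-rotate (tri (a₁ , a₂) (b₁ , b₂) (c₁ , c₂)) =
    solve 6 (λ a₁ a₂ b₁ b₂ c₁ c₂ →
      let open Coordinates (polynomials 6); A = (a₁ , a₂); B = (b₁ , b₂); C = (c₁ , c₂) in
      area B C A := area A B C)
      refl a₁ a₂ b₁ b₂ c₁ c₂

  ⊕-rotate : ∀ P Q R → P ⊕ (Q ⊕ R) ≡ Q ⊕ (R ⊕ P)
  ⊕-rotate (p₁ , p₂) (q₁ , q₂) (r₁ , r₂) = cong₂ _,_ (+-rotate p₁ q₁ r₁) (+-rotate p₂ q₂ r₂)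
    where
    +-rotate : ∀ x y z → x + (y + z) ≡ y + (z + x)
    +-rotate = solve 3 (λ x y z → x :+ (y :+ z) := y :+ (z :+ x)) refl

  ∈-rotate : ∀ {p} T → p ∈T T → p ∈T rotate T
  ∈-rotate (tri A B C) (α , β , γ , 0≤α , 0≤β , 0≤γ , α+β+γ≡1 , p≡) =
    β , γ , α , 0≤β , 0≤γ , 0≤α ,
    trans (solve 3 (λ α β γ → β :+ γ :+ α := α :+ β :+ γ) refl α β γ) α+β+γ≡1 ,
    trans p≡ (⊕-rotate (α · A) (β · B) (γ · C))

  barycenter-rotate : ∀ {g} T → IsBarycenter g T → IsBarycenter g (rotate T)
  barycenter-rotate (tri A B C) 3g≡A+B+C = trans 3g≡A+B+C (⊕-rotate A B C)

  second-vertex-∈ : ∀ T → Triangle.B T ∈T T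
  second-vertex-∈ (tri (a₁ , a₂) (b₁ , b₂) (c₁ , c₂)) =
    0# , 1# , 0# , inj₂ refl , inj₁ 0<1 , inj₂ refl ,
    trans (+-identityʳ (0# + 1#)) (+-identityˡ 1#) ,
    cong₂ _,_ (pick a₁ b₁ c₁) (pick a₂ b₂ c₂)
    where
    pick : ∀ x y z → y ≡ 0# * x + (1# * y + 0# * z)
    pick = solve 3 (λ x y z → y := :0 :* x :+ (:1 :* y :+ :0 :* z)) refl

  data Side : Set where
    BC CA AB : Side

  -- relabel the vertices of T cyclically so that side i becomes the side through B and C
  orient : Side → Triangle → Triangle
  orient BC T = T
  orient CA T = rotate T
  orient AB T = rotate (rotate T)

  area-orient : ∀ i T → areaOf (orient i T) ≡ areaOf T
  area-orient BC T = refl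
  area-orient CA T = area-rotate T
  area-orient AB T = trans (area-rotate (rotate T)) (area-rotate T)

  ∈-orient : ∀ {p} i T → p ∈T T → p ∈T orient i T
  ∈-orient BC T p∈T = p∈T
  ∈-orient CA T p∈T = ∈-rotate T p∈T
  ∈-orient AB T p∈T = ∈-rotate (rotate T) (∈-rotate T p∈T)

  -- three rotations are the identity, so one or two more undo an orientation
  ∈-orient⁻¹ : ∀ {p} i T → p ∈T orient i T → p ∈T T
  ∈-orient⁻¹ BC T p∈T = p∈T
  ∈-orient⁻¹ CA T p∈T = ∈-rotate (rotate (rotate T)) (∈-rotate (rotate T) p∈T)
  ∈-orient⁻¹ AB T p∈T = ∈-rotate (rotate (rotate T)) p∈T

  barycenter-orient : ∀ {g} i T → IsBarycenter g T → IsBarycenter g (orient i T)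
  barycenter-orient BC T bary = bary
  barycenter-orient CA T bary = barycenter-rotate T bary
  barycenter-orient AB T bary = barycenter-rotate (rotate T) (barycenter-rotate T bary)

  orient-homothet : ∀ i T s t → orient i (homothet T s t) ≡ homothet (orient i T) s t
  orient-homothet BC T s t = refl
  orient-homothet CA T s t = refl
  orient-homothet AB T s t = refl

  height-of-combination : ∀ T s t α β γ →
    heightOf T (combination (homothet T s t) α β γ) ≡ (α + β + γ) * levelOf T s t + α * s * (areaOf T * areaOf T)
  height-of-combination (tri (a₁ , a₂) (b₁ , b₂) (c₁ , c₂)) s (t₁ , t₂) α β γ =
    solve 12 (λ a₁ a₂ b₁ b₂ c₁ c₂ s t₁ t₂ α β γ →
      let open Coordinates (polynomials 12); A = (a₁ , a₂); B = (b₁ , b₂); C = (c₁ , c₂); t = (t₁ , t₂) in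
      height A B C (comb (hom s t A) (hom s t B) (hom s t C) α β γ)
        := (α :+ β :+ γ) :* level A B C s t :+ α :* s :* (area A B C :* area A B C))
      refl a₁ a₂ b₁ b₂ c₁ c₂ s t₁ t₂ α β γ

  level≤height : ∀ T {s t p} → 0# ≤ s → p ∈T homothet T s t → levelOf T s t ≤ heightOf T p
  level≤height T {s} {t} 0≤s (α , β , γ , 0≤α , _ , _ , α+β+γ≡1 , refl) =
    ≤-by-gap (α * s * d) (nonneg-* (nonneg-* 0≤α 0≤s) (square-nonneg (areaOf T))) (begin
      L + α * s * d                    ≡⟨ cong (_+ α * s * d) (sym (*-identityˡ L)) ⟩
      1# * L + α * s * d               ≡⟨ cong (λ k → k * L + α * s * d) (sym α+β+γ≡1) ⟩
      (α + β + γ) * L + α * s * d      ≡⟨ sym (height-of-combination T s t α β γ) ⟩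
      heightOf T (combination (homothet T s t) α β γ) ∎)
    where
    open ≡-Reasoning
    L = levelOf T s t
    d = areaOf T * areaOf T

  height-segment : ∀ T s P Q → heightOf T (((1# - s) · P) ⊕ (s · Q)) ≡ mix s (heightOf T P) (heightOf T Q)
  height-segment (tri (a₁ , a₂) (b₁ , b₂) (c₁ , c₂)) s (p₁ , p₂) (q₁ , q₂) =
    solve 11 (λ a₁ a₂ b₁ b₂ c₁ c₂ s p₁ p₂ q₁ q₂ →
      let open Coordinates (polynomials 11); A = (a₁ , a₂); B = (b₁ , b₂); C = (c₁ , c₂); P = (p₁ , p₂); Q = (q₁ , q₂) in
      height A B C (((:1 :- s) ·ᵥ P) +ᵥ (s ·ᵥ Q)) := (:1 :- s) :* height A B C P :+ s :* height A B C Q)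
      refl a₁ a₂ b₁ b₂ c₁ c₂ s p₁ p₂ q₁ q₂

  barycenter-height : ∀ T {s t g} → IsBarycenter g (homothet T s t) →
    triple (heightOf T g) ≡ triple (levelOf T s t) + s * (areaOf T * areaOf T)
  barycenter-height T@(tri (a₁ , a₂) (b₁ , b₂) (c₁ , c₂)) {s} {t@(t₁ , t₂)} {g@(g₁ , g₂)} 3g≡A+B+C = begin
    triple (heightOf T g)                                  ≡⟨ height-triple ⟩
    heightOf T (g ⊕ (g ⊕ g))                               ≡⟨ cong (heightOf T) 3g≡A+B+C ⟩
    heightOf T (Triangle.A T′ ⊕ (Triangle.B T′ ⊕ Triangle.C T′)) ≡⟨ height-vertex-sum ⟩
    triple (levelOf T s t) + s * (areaOf T * areaOf T)     ∎
    where
    open ≡-Reasoning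
    T′ = homothet T s t
    height-triple : triple (heightOf T g) ≡ heightOf T (g ⊕ (g ⊕ g))
    height-triple = solve 8 (λ a₁ a₂ b₁ b₂ c₁ c₂ g₁ g₂ →
      let open Coordinates (polynomials 8); A = (a₁ , a₂); B = (b₁ , b₂); C = (c₁ , c₂); g = (g₁ , g₂) in
      height A B C g :+ (height A B C g :+ height A B C g) := height A B C (g +ᵥ (g +ᵥ g)))
      refl a₁ a₂ b₁ b₂ c₁ c₂ g₁ g₂
    height-vertex-sum : heightOf T (Triangle.A T′ ⊕ (Triangle.B T′ ⊕ Triangle.C T′)) ≡ triple (levelOf T s t) + s * (areaOf T * areaOf T)
    height-vertex-sum = solve 9 (λ a₁ a₂ b₁ b₂ c₁ c₂ s t₁ t₂ →
      let open Coordinates (polynomials 9); A = (a₁ , a₂); B = (b₁ , b₂); C = (c₁ , c₂); t = (t₁ , t₂) in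
      height A B C (hom s t A +ᵥ (hom s t B +ᵥ hom s t C))
        := level A B C s t :+ (level A B C s t :+ level A B C s t) :+ s :* (area A B C :* area A B C))
      refl a₁ a₂ b₁ b₂ c₁ c₂ s t₁ t₂

  -- the gaps of p at the three sides are its barycentric coordinates in s·T + t,
  -- scaled by s·area²: they sum to s·area² …
  gaps-sum : ∀ T s t p →
    gapOf (orient BC T) s t p + gapOf (orient CA T) s t p + gapOf (orient AB T) s t p ≡ s * (areaOf T * areaOf T)
  gaps-sum (tri (a₁ , a₂) (b₁ , b₂) (c₁ , c₂)) s (t₁ , t₂) (p₁ , p₂) =
    solve 11 (λ a₁ a₂ b₁ b₂ c₁ c₂ s t₁ t₂ p₁ p₂ →
      let open Coordinates (polynomials 11); A = (a₁ , a₂); B = (b₁ , b₂); C = (c₁ , c₂); t = (t₁ , t₂); p = (p₁ , p₂) in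
      gap A B C s t p :+ gap B C A s t p :+ gap C A B s t p
        := s :* (area A B C :* area A B C))
      refl a₁ a₂ b₁ b₂ c₁ c₂ s t₁ t₂ p₁ p₂

  gaps-combination : ∀ T s t p w →
    combination (homothet T s t) (gapOf (orient BC T) s t p * w) (gapOf (orient CA T) s t p * w) (gapOf (orient AB T) s t p * w)
      ≡ (w * (s * (areaOf T * areaOf T))) · p
  gaps-combination (tri (a₁ , a₂) (b₁ , b₂) (c₁ , c₂)) s (t₁ , t₂) (p₁ , p₂) w =
    cong₂ _,_
      (solve 12 (λ a₁ a₂ b₁ b₂ c₁ c₂ s t₁ t₂ p₁ p₂ w →
        let open Coordinates (polynomials 12); A = (a₁ , a₂); B = (b₁ , b₂); C = (c₁ , c₂); t = (t₁ , t₂); p = (p₁ , p₂) in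
        proj₁ (comb (hom s t A) (hom s t B) (hom s t C) (gap A B C s t p :* w) (gap B C A s t p :* w) (gap C A B s t p :* w))
          := w :* (s :* (area A B C :* area A B C)) :* p₁)
        refl a₁ a₂ b₁ b₂ c₁ c₂ s t₁ t₂ p₁ p₂ w)
      (solve 12 (λ a₁ a₂ b₁ b₂ c₁ c₂ s t₁ t₂ p₁ p₂ w →
        let open Coordinates (polynomials 12); A = (a₁ , a₂); B = (b₁ , b₂); C = (c₁ , c₂); t = (t₁ , t₂); p = (p₁ , p₂) in
        proj₂ (comb (hom s t A) (hom s t B) (hom s t C) (gap A B C s t p :* w) (gap B C A s t p :* w) (gap C A B s t p :* w))
          := w :* (s :* (area A B C :* area A B C)) :* p₂)
        refl a₁ a₂ b₁ b₂ c₁ c₂ s t₁ t₂ p₁ p₂ w)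

  heights⇒∈ : ∀ T {s t p} → areaOf T ≢ 0# → 0# < s →
    (∀ i → levelOf (orient i T) s t ≤ heightOf (orient i T) p) → p ∈T homothet T s t
  heights⇒∈ T {s} {t} {p} area≢0 0<s above =
    coefficient BC , coefficient CA , coefficient AB ,
    nonneg BC , nonneg CA , nonneg AB , coefficients-sum , p≡combination
    where
    open ≡-Reasoning
    K = s * (areaOf T * areaOf T)
    0<K : 0# < K
    0<K = *-pos _ _ 0<s (square-pos area≢0)
    K⁻¹ : ∃[ w ] (K * w ≡ 1#)
    K⁻¹ = inverse K (λ K≡0 → <-irrefl (subst (0# <_) K≡0 0<K))
    w = proj₁ K⁻¹
    K*w≡1 : K * w ≡ 1#
    K*w≡1 = proj₂ K⁻¹
    n : Side → Carrier
    n i = gapOf (orient i T) s t p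
    coefficient : Side → Carrier
    coefficient i = n i * w
    nonneg : ∀ i → 0# ≤ coefficient i
    nonneg i = nonneg-* (gap-nonneg (above i)) (inj₁ (inverse-pos 0<K K*w≡1))
    coefficients-sum : coefficient BC + coefficient CA + coefficient AB ≡ 1#
    coefficients-sum = begin
      n BC * w + n CA * w + n AB * w  ≡⟨ solve 4 (λ x y z w → x :* w :+ y :* w :+ z :* w := (x :+ y :+ z) :* w) refl (n BC) (n CA) (n AB) w ⟩
      (n BC + n CA + n AB) * w        ≡⟨ cong (_* w) (gaps-sum T s t p) ⟩
      K * w                           ≡⟨ K*w≡1 ⟩
      1#                              ∎
    p≡combination : p ≡ combination (homothet T s t) (coefficient BC) (coefficient CA) (coefficient AB)
    p≡combination = begin
      p                 ≡⟨ sym (·-identity p) ⟩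
      1# · p            ≡⟨ cong (_· p) (sym (trans (*-comm w K) K*w≡1)) ⟩
      (w * K) · p       ≡⟨ sym (gaps-combination T s t p w) ⟩
      combination (homothet T s t) (coefficient BC) (coefficient CA) (coefficient AB) ∎
      where
      ·-identity : ∀ q → 1# · q ≡ q
      ·-identity (q₁ , q₂) = cong₂ _,_ (*-identityˡ q₁) (*-identityˡ q₂)

module Drawing {c ℓ} (F : OrderedField c ℓ) {n : ℕ} (G : Graph n) (R : Representation.BTCRep F G)
               (g : Fin n → Geometry.Point F) (bary : ∀ v → Geometry.IsBarycenter F (g v) (Representation.BTCRep.T R v)) where
  open OrderedField F
  open Geometry F
  open Representation F
  open BTCRep R
  open Graph G
  open OrderedFieldFacts F
  open TriangleHeights F

  height : Side → Point → Carrier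
  height i = heightOf (orient i T₀)

  level : Side → Fin n → Carrier
  level i v = levelOf (orient i T₀) (scale v) (shift v)

  -- the height of the opposite vertex above side i in T v, divided by scale v
  weight : Side → Carrier
  weight i = areaOf (orient i T₀) * areaOf (orient i T₀)

  weight-pos : ∀ i → 0# < weight i
  weight-pos i = square-pos (λ area≡0 → T₀-nondeg (trans (sym (area-orient i T₀)) area≡0))

  ∈⇒above : ∀ {v p} i → p ∈T T v → level i v ≤ height i p
  ∈⇒above {v} {p} i p∈Tv = level≤height (orient i T₀) (inj₁ (scale-pos v))
    (subst (p ∈T_) (orient-homothet i T₀ (scale v) (shift v)) (∈-orient i (T v) p∈Tv))

  above⇒∈ : ∀ {v p} → (∀ i → level i v ≤ height i p) → p ∈T T v
  above⇒∈ {v} = heights⇒∈ T₀ T₀-nondeg (scale-pos v)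

  Dominates : Fin n → Fin n → Set (c ⊔ ℓ)
  Dominates a b = ∀ i → level i b ≤ level i a

  ⊆⇒dominates : ∀ {a b} → T a ⊆T T b → Dominates a b
  ⊆⇒dominates {a} Ta⊆Tb i = ∈⇒above i (Ta⊆Tb corner corner∈Ta)
    where
    -- the vertex of T a on its side i: its height is the level of that side
    T′ = homothet (orient i T₀) (scale a) (shift a)
    corner = Triangle.B T′
    corner∈Ta : corner ∈T T a
    corner∈Ta = ∈-orient⁻¹ i (T a) (subst (corner ∈T_) (sym (orient-homothet i T₀ (scale a) (shift a))) (second-vertex-∈ T′))

  dominates⇒⊆ : ∀ {a b} → Dominates a b → T a ⊆T T b
  dominates⇒⊆ dom p p∈Ta = above⇒∈ (λ i → ≤-trans (dom i) (∈⇒above i p∈Ta))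

  Comparable : Fin n → Fin n → Set (c ⊔ ℓ)
  Comparable a b = Dominates a b ⊎ Dominates b a

  edge⇒distinct : ∀ {a b} → Edge G a b → a ≢ b
  edge⇒distinct {a} ab refl with trans (sym ab) (adj-irrefl a)
  ... | ()

  edge⇒comparable : ∀ {a b} → Edge G a b → Comparable a b
  edge⇒comparable {a} {b} ab with Equivalence.to (represents a b (edge⇒distinct ab)) ab
  ... | inj₁ Ta⊆Tb = inj₁ (⊆⇒dominates Ta⊆Tb)
  ... | inj₂ Tb⊆Ta = inj₂ (⊆⇒dominates Tb⊆Ta)

  comparable⇒edge : ∀ {a b} → a ≢ b → Comparable a b → Edge G a b
  comparable⇒edge {a} {b} a≢b (inj₁ dom) = Equivalence.from (represents a b a≢b) (inj₁ (dominates⇒⊆ dom))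
  comparable⇒edge {a} {b} a≢b (inj₂ dom) = Equivalence.from (represents a b a≢b) (inj₂ (dominates⇒⊆ dom))

  barycenter-level : ∀ i v → triple (height i (g v)) ≡ triple (level i v) + scale v * weight i
  barycenter-level i v = barycenter-height (orient i T₀)
    (subst (IsBarycenter (g v)) (orient-homothet i T₀ (scale v) (shift v)) (barycenter-orient i (T v) (bary v)))

  levelAt : Fin n → Fin n → Carrier → Side → Carrier
  levelAt a b s i = mix s (level i a) (level i b)

  scaleAt : Fin n → Fin n → Carrier → Carrier
  scaleAt a b s = mix s (scale a) (scale b)

  segment-level : ∀ {a b s p} i → p ≡ ((1# - s) · g a) ⊕ (s · g b) →
    triple (height i p) ≡ triple (levelAt a b s i) + scaleAt a b s * weight i
  segment-level {a} {b} {s} i refl =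
    trans (cong triple (height-segment (orient i T₀) s (g a) (g b)))
          (triple-mix s (weight i) (barycenter-level i a) (barycenter-level i b))

  Endpoint : Fin n → Fin n → Fin n → Set
  Endpoint a b w = w ≡ a ⊎ w ≡ b

  record Straddle (a b : Fin n) (s : Carrier) : Set (c ⊔ ℓ) where
    field
      inner outer : Fin n
      inner-endpoint : Endpoint a b inner
      outer-endpoint : Endpoint a b outer
      below : ∀ i → level i outer ≤ levelAt a b s i
      above : ∀ i → levelAt a b s i ≤ level i inner

  edge-straddle : ∀ {a b s} → Edge G a b → 0# ≤ s → s ≤ 1# → Straddle a b s
  edge-straddle {a} {b} ab 0≤s s≤1 with edge⇒comparable ab
  ... | inj₁ a-dom-b = record
    { inner = a ; outer = b ; inner-endpoint = inj₁ refl ; outer-endpoint = inj₂ refl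
    ; below = λ i → proj₁ (mix-between′ 0≤s s≤1 (a-dom-b i))
    ; above = λ i → proj₂ (mix-between′ 0≤s s≤1 (a-dom-b i)) }
  ... | inj₂ b-dom-a = record
    { inner = b ; outer = a ; inner-endpoint = inj₂ refl ; outer-endpoint = inj₁ refl
    ; below = λ i → proj₁ (mix-between 0≤s s≤1 (b-dom-a i))
    ; above = λ i → proj₂ (mix-between 0≤s s≤1 (b-dom-a i)) }

  dominance-across : ∀ {u v x y s r} → Edge G u v → Edge G x y →
    0# ≤ s → s ≤ 1# → 0# ≤ r → r ≤ 1# →
    (∀ i → triple (levelAt u v s i) + scaleAt u v s * weight i ≡ triple (levelAt x y r i) + scaleAt x y r * weight i) →
    scaleAt u v s ≤ scaleAt x y r →
    Σ (Fin n) λ a → Σ (Fin n) λ b → Endpoint u v a × Endpoint x y b × Dominates a b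
  dominance-across {u} {v} {x} {y} {s} {r} uv xy 0≤s s≤1 0≤r r≤1 same-height σ≤τ =
    S.inner , S′.outer , S.inner-endpoint , S′.outer-endpoint ,
    λ i → ≤-trans (S′.below i) (≤-trans (xy-below-uv i) (S.above i))
    where
    module S  = Straddle (edge-straddle uv 0≤s s≤1)
    module S′ = Straddle (edge-straddle xy 0≤r r≤1)
    xy-below-uv : ∀ i → levelAt x y r i ≤ levelAt u v s i
    xy-below-uv i = triple-reflects-≤ (≤-cancel-weighted (same-height i) σ≤τ (inj₁ (weight-pos i)))

  cross-pair : ∀ {u v x y a b} → StronglyIndependent G u v x y → Endpoint u v a → Endpoint x y b →
    a ≢ b × adj a b ≡ false
  cross-pair (_ , _ , u≢x , _   , _   , _   , ux , _  , _  , _ ) (inj₁ refl) (inj₁ refl) = u≢x , ux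
  cross-pair (_ , _ , _   , u≢y , _   , _   , _  , uy , _  , _ ) (inj₁ refl) (inj₂ refl) = u≢y , uy
  cross-pair (_ , _ , _   , _   , v≢x , _   , _  , _  , vx , _ ) (inj₂ refl) (inj₁ refl) = v≢x , vx
  cross-pair (_ , _ , _   , _   , _   , v≢y , _  , _  , _  , vy) (inj₂ refl) (inj₂ refl) = v≢y , vy

  separated : ∀ {u v x y a b} → StronglyIndependent G u v x y → Endpoint u v a → Endpoint x y b → ¬ Comparable a b
  separated si a∈uv b∈xy comparable with cross-pair si a∈uv b∈xy
  ... | a≢b , ab≡false with trans (sym (comparable⇒edge a≢b comparable)) ab≡false
  ...   | ()

  meeting-levels : ∀ {u v x y s r p} →
    p ≡ ((1# - s) · g u) ⊕ (s · g v) → p ≡ ((1# - r) · g x) ⊕ (r · g y) → ∀ i →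
    triple (levelAt u v s i) + scaleAt u v s * weight i ≡ triple (levelAt x y r i) + scaleAt x y r * weight i
  meeting-levels p-on-uv p-on-xy i = trans (sym (segment-level i p-on-uv)) (segment-level i p-on-xy)

  no-crossing : ∀ u v x y → StronglyIndependent G u v x y → ¬ SegmentsMeet (g u) (g v) (g x) (g y)
  no-crossing u v x y si@(uv , xy , _) (p , (s , 0≤s , s≤1 , p-on-uv) , (r , 0≤r , r≤1 , p-on-xy))
    with ≤-total (scaleAt u v s) (scaleAt x y r)
  ... | inj₁ σ≤τ =
    let (a , b , a∈uv , b∈xy , a-dom-b) = dominance-across uv xy 0≤s s≤1 0≤r r≤1 (meeting-levels p-on-uv p-on-xy) σ≤τ
    in separated si a∈uv b∈xy (inj₁ a-dom-b)
  ... | inj₂ τ≤σ =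
    let (b , a , b∈xy , a∈uv , b-dom-a) = dominance-across xy uv 0≤r r≤1 0≤s s≤1 (meeting-levels p-on-xy p-on-uv) τ≤σ
    in separated si a∈uv b∈xy (inj₂ b-dom-a)

lemma4 : ∀ {c ℓ : Level} (F : OrderedField c ℓ) →
    let open Geometry F in
    let open Representation F in
    ∀ {n : ℕ} (G : Graph n) → IsBipartite G →
    (R : BTCRep G) →
    -- β(G): each vertex placed at the barycenter of its triangle
    (g : Fin n → Point) → (∀ v → IsBarycenter (g v) (BTCRep.T R v)) →
    -- barycenters pairwise distinct
    (∀ u v → u ≢ v → g u ≢ g v) →
    ∀ u v x y → StronglyIndependent G u v x y →
    ¬ SegmentsMeet (g u) (g v) (g x) (g y)
lemma4 F G _ R g bary _ = Drawing.no-crossing F G R g bary
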